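{- Let $G$ be a noncyclic finite group of order $n$. Let $M_1,\ldots,M_t$ be all the maximal cyclic subgroups of $G$, with $|M_i|=n_i$ for $1\le i\le t$ and $n_t\le n_{t-1}\le\cdots\le n_1$. If $|M_i\cap M_j|=1$ for all $1\le i<j\le t$ and $n_1+t-2\le\sum_{i=2}^{t} n_i$, then $\lambda(\Gamma_G)=n$.
   Context: The (undirected) power graph $\Gamma_G$ of a finite group $G$ has vertex set $G$, two distinct elements being adjacent if one is a power of the other. A maximal cyclic subgroup is a cyclic subgroup not properly contained in another cyclic subgroup. An $L(2,1)$-labeling of a graph $\Gamma$ is a function $f:V(\Gamma)\to\mathbb{Z}_{\ge 0}$ such that $|f(u)-f(v)|\ge 2$ for adjacent $u,v$ and $|f(u)-f(v)|\ge 1$ for $u,v$ at distance two; its span is $\max f-\min f$, and $\lambda(\Gamma)$ is the minimum span over all $L(2,1)$-labelings of $\Gamma$. -}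

module Defs where

open import Data.Nat using (ℕ; zero; suc; _+_; _≤_)
open import Data.Fin using (Fin)
open import Data.List using (List; length)
open import Data.List.Membership.Propositional using (_∈_)
open import Data.List.Relation.Unary.Unique.Propositional using (Unique)
open import Data.Product using (Σ; ∃; ∃-syntax; _×_)
open import Data.Sum using (_⊎_)
open import Relation.Nullary using (¬_)
open import Relation.Binary.PropositionalEquality using (_≡_)
open import Algebra.Structures using (IsGroup)

-- A finite group of order n, presented on the carrier Fin n
-- (every finite group of order n is isomorphic to one of these).
record FiniteGroup (n : ℕ) : Set where
  field
    _∙_     : Fin n → Fin n → Fin n
    ε       : Fin n
    _⁻¹     : Fin n → Fin n
    isGroup : IsGroup _≡_ _∙_ ε _⁻¹

module _ {n : ℕ} (G : FiniteGroup n) where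
  open FiniteGroup G

  pow : Fin n → ℕ → Fin n
  pow x zero    = ε
  pow x (suc k) = x ∙ pow x k

  IsPowerOf : Fin n → Fin n → Set
  IsPowerOf y x = ∃[ k ] y ≡ pow x k

  ⟨_⟩ : Fin n → Fin n → Set
  ⟨ g ⟩ x = IsPowerOf x g

  IsCyclic : Set
  IsCyclic = ∃[ g ] (∀ x → ⟨ g ⟩ x)

  IsMaxCyclicGen : Fin n → Set
  IsMaxCyclicGen g = ∀ h → (∀ x → ⟨ g ⟩ x → ⟨ h ⟩ x) → (∀ x → ⟨ h ⟩ x → ⟨ g ⟩ x)

  SameSubgroup : Fin n → Fin n → Set
  SameSubgroup g h = ∀ x → (⟨ g ⟩ x → ⟨ h ⟩ x) × (⟨ h ⟩ x → ⟨ g ⟩ x)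

  -- M₁,…,M_t (M i = ⟨ gens i ⟩) is a repetition-free list of ALL maximal cyclic subgroups
  AllMaxCyclic : (t : ℕ) → (Fin t → Fin n) → Set
  AllMaxCyclic t gens =
    (∀ i → IsMaxCyclicGen (gens i)) ×
    (∀ i j → SameSubgroup (gens i) (gens j) → i ≡ j) ×
    (∀ h → IsMaxCyclicGen h → ∃[ i ] SameSubgroup h (gens i))

  Adj : Fin n → Fin n → Set
  Adj u v = ¬ (u ≡ v) × (IsPowerOf u v ⊎ IsPowerOf v u)

  Dist2 : Fin n → Fin n → Set
  Dist2 u v = ¬ (u ≡ v) × ¬ Adj u v × ∃[ w ] (Adj u w × Adj w v)

HasSize : {n : ℕ} → (Fin n → Set) → ℕ → Set
HasSize {n} P m = Σ (List (Fin n)) λ xs →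
  Unique xs × (∀ x → (P x → x ∈ xs) × (x ∈ xs → P x)) × length xs ≡ m

FarBy : ℕ → ℕ → ℕ → Set
FarBy d a b = (a + d ≤ b) ⊎ (b + d ≤ a)

module _ {n : ℕ} (G : FiniteGroup n) where

  IsL21Labeling : (Fin n → ℕ) → Set
  IsL21Labeling f =
    (∀ u v → Adj G u v → FarBy 2 (f u) (f v)) ×
    (∀ u v → Dist2 G u v → FarBy 1 (f u) (f v))

  IsSpan : (Fin n → ℕ) → ℕ → Set
  IsSpan f s = (∀ u v → f u ≤ f v + s) × ∃[ u ] ∃[ v ] f u ≡ f v + s

  LambdaIs : ℕ → Set
  LambdaIs s =
    (∃[ f ] (IsL21Labeling f × IsSpan f s)) ×
    (∀ f s' → IsL21Labeling f → IsSpan f s' → s ≤ s')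

module Submission where

-- The identity ε is adjacent to every vertex of the power graph, so any two vertices are at
-- distance at most two: an L(2,1)-labelling f is injective, and no vertex gets a label next to
-- f ε. As G is noncyclic there is a second vertex, and the value next to f ε in its direction
-- is an unused value within the range of f; hence n + 1 distinct values fit in the span, which
-- is therefore at least n.
--
-- Conversely, the maximal cyclic subgroups cover G and meet trivially, so the sets Mᵢ ∖ {ε}
-- partition G ∖ {ε}, and adjacent nonidentity vertices lie in the same Mᵢ. List G ∖ {ε} block
-- by block; the hypothesis n₁ + t − 2 ≤ n₂ + ⋯ + n_t makes every block at most h = ⌊N/2⌋
-- long (N = n − 1), so two vertices of one block sit fewer than h positions apart. Give ε the
-- label 0 and the vertex in position p the label 2 + π p, where π sends p < h to 2p + 1 and
-- p ≥ h to 2(p − h). Then π permutes [0, N) and consecutive values of π come from positions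
-- at least h apart, so adjacent vertices get labels at least 2 apart; the largest label is
-- N + 1 = n.

open import Defs

open import Algebra.Bundles using (Group)
import Algebra.Properties.Group as GroupProperties
import Algebra.Properties.Monoid.Mult as MonoidMultiplication
open import Algebra.Structures using (IsGroup)
open import Data.Fin using (Fin; toℕ; fromℕ<) renaming (zero to fzero; suc to fsuc)
open import Data.Fin.Properties using (_≟_; any?; injective⇒≤; pigeonhole; toℕ<n; toℕ-fromℕ<; toℕ-injective)
open import Data.List using (List; []; _∷_; length; concat; tabulate; lookup; filter; allFin)
open import Data.List.Membership.Propositional using (_∈_; _∉_; lose)
open import Data.List.Membership.Propositional.Properties using (∈-lookup; ∈-allFin; ∈-filter⁺; ∈-filter⁻; ∈-concat⁻′; ∈-tabulate⁻)
open import Data.List.Extrema.Nat using (argmax; argmin; argmax-all; f[xs]≤f[argmax]; f[argmin]≤f[xs])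
open import Data.List.Properties using (length-++; filter-accept; filter-reject; filter-all; tabulate-cong)
open import Data.List.Relation.Binary.Disjoint.Propositional using (Disjoint)
open import Data.List.Relation.Unary.All as All using (_∷_)
open import Data.List.Relation.Unary.All.Properties using (all-filter; ¬Any⇒All¬)
import Data.List.Relation.Unary.All.Properties as Allₚ
open import Data.List.Relation.Unary.Any using (Any; here; there; index)
open import Data.List.Relation.Unary.Any.Properties using (lookup-index; ++⁺ˡ; ++⁺ʳ)
open import Data.List.Relation.Unary.AllPairs using (_∷_)
import Data.List.Relation.Unary.AllPairs.Properties as AllPairsₚ
open import Data.List.Relation.Unary.Unique.Propositional using (Unique)
import Data.List.Relation.Unary.Unique.Propositional.Properties as Uniqueₚ
open import Data.Nat using (ℕ; zero; suc; _+_; _*_; _∸_; _≤_; _<_; z≤n; s≤s; s≤s⁻¹; _<?_; ⌊_/2⌋)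
open import Data.Nat.DivMod using (_%_; _/_; m≡m%n+[m/n]*n; m%n<n)
open import Data.Nat.ListAction using (sum)
open import Data.Nat.Properties hiding (_≟_)
open import Data.Product using (∃; ∃-syntax; _×_; _,_; proj₁; proj₂)
open import Data.Sum using (_⊎_; inj₁; inj₂)
open import Function using (_∘_; case_of_)
open import Level using (0ℓ)
open import Relation.Nullary using (¬_; ¬?; yes; no; contradiction)
open import Relation.Nullary.Decidable using (map′; decidable-stable)
open import Relation.Unary using (Pred; Decidable)
open import Relation.Binary.Definitions using (DecidableEquality; tri<; tri≈; tri>)
open import Relation.Binary.PropositionalEquality

FarBy⇒≢ : ∀ {d a b} → FarBy (suc d) a b → a ≢ b
FarBy⇒≢ {a = a} (inj₁ a+d<a) refl = m+1+n≰m a a+d<a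
FarBy⇒≢ {a = a} (inj₂ a+d<a) refl = m+1+n≰m a a+d<a

FarBy⇒+ : ∀ {d a b} → FarBy d a b → d + a ≤ b ⊎ d + b ≤ a
FarBy⇒+ {d} {a} {b} (inj₁ le) = inj₁ (subst (_≤ b) (+-comm a d) le)
FarBy⇒+ {d} {a} {b} (inj₂ le) = inj₂ (subst (_≤ a) (+-comm b d) le)

≢⇒FarBy₁ : ∀ {a b} → a ≢ b → FarBy 1 a b
≢⇒FarBy₁ {a} {b} a≢b with <-cmp a b
... | tri< a<b _ _ = inj₁ (subst (_≤ b) (+-comm 1 a) a<b)
... | tri≈ _ a≡b _ = contradiction a≡b a≢b
... | tri> _ _ b<a = inj₂ (subst (_≤ a) (+-comm 1 b) b<a)

FarBy₂-intro : ∀ {a b} → a ≢ b → suc a ≢ b → suc b ≢ a → FarBy 2 a b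
FarBy₂-intro {a} {b} a≢b 1+a≢b 1+b≢a with <-cmp a b
... | tri< a<b _ _ = inj₁ (subst (_≤ b) (+-comm 2 a) (≤∧≢⇒< a<b 1+a≢b))
... | tri≈ _ a≡b _ = contradiction a≡b a≢b
... | tri> _ _ b<a = inj₂ (subst (_≤ a) (+-comm 2 b) (≤∧≢⇒< b<a 1+b≢a))

Neighbours : ℕ → ℕ → Set
Neighbours a c = suc a ≡ c ⊎ suc c ≡ a

neighbour-≢-FarBy₂ : ∀ {a b c} → FarBy 2 a b → Neighbours a c → c ≢ b
neighbour-≢-FarBy₂ far next refl with FarBy⇒+ far | next
... | inj₁ 2+a≤c | inj₁ refl = 1+n≰n 2+a≤c
... | inj₁ 2+a≤c | inj₂ refl = 1+n≰n (≤-trans (m≤n+m _ 2) 2+a≤c)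
... | inj₂ 2+c≤a | inj₁ refl = 1+n≰n (≤-trans (m≤n+m _ 2) 2+c≤a)
... | inj₂ 2+c≤a | inj₂ refl = 1+n≰n 2+c≤a

neighbour-towards : ∀ {lo hi a b} → lo ≤ a → a ≤ hi → lo ≤ b → b ≤ hi → FarBy 2 a b →
  ∃[ c ] Neighbours a c × lo ≤ c × c ≤ hi
neighbour-towards {a = a} lo≤a a≤hi lo≤b b≤hi far with FarBy⇒+ far
... | inj₁ 2+a≤b = suc a , inj₁ refl , ≤-trans lo≤a (n≤1+n a) , ≤-trans (≤-trans (n≤1+n _) 2+a≤b) b≤hi
... | inj₂ (s≤s 1+b≤c) = _ , inj₂ refl , ≤-trans lo≤b (≤-trans (n≤1+n _) 1+b≤c) , ≤-trans (n≤1+n _) a≤hi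

⌊n/2⌋-bounds : ∀ n → 2 * ⌊ n /2⌋ ≤ n × n ≤ suc (2 * ⌊ n /2⌋)
⌊n/2⌋-bounds zero = z≤n , z≤n
⌊n/2⌋-bounds (suc zero) = z≤n , ≤-refl
⌊n/2⌋-bounds (suc (suc n)) with ⌊n/2⌋-bounds n
... | lo , hi = subst (_≤ 2 + n) (sym (*-suc 2 ⌊ n /2⌋)) (s≤s (s≤s lo)) ,
                subst (2 + n ≤_) (cong suc (sym (*-suc 2 ⌊ n /2⌋))) (s≤s (s≤s hi))

m+m≤n⇒m≤⌊n/2⌋ : ∀ {m n} → m + m ≤ n → m ≤ ⌊ n /2⌋
m+m≤n⇒m≤⌊n/2⌋ {m} m+m≤n = subst (_≤ _) (sym (n≡⌊n+n/2⌋ m)) (⌊n/2⌋-mono m+m≤n)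

injective-bounded⇒≤ : ∀ {m a s} (f : Fin m → ℕ) → (∀ {i j} → f i ≡ f j → i ≡ j) →
  (∀ i → a ≤ f i) → (∀ i → f i ≤ a + s) → m ≤ suc s
injective-bounded⇒≤ {m} {a} {s} f f-injective a≤f f≤a+s = injective⇒≤ shifted-injective
  where
  shifted< : ∀ i → f i ∸ a < suc s
  shifted< i = s≤s (subst (f i ∸ a ≤_) (m+n∸m≡n a s) (∸-monoˡ-≤ a (f≤a+s i)))
  shifted : Fin m → Fin (suc s)
  shifted i = fromℕ< (shifted< i)
  shifted-injective : ∀ {i j} → shifted i ≡ shifted j → i ≡ j
  shifted-injective {i} {j} eq = f-injective (∸-cancelʳ-≡ (a≤f i) (a≤f j)
    (trans (sym (toℕ-fromℕ< (shifted< i))) (trans (cong toℕ eq) (toℕ-fromℕ< (shifted< j)))))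

module Interleaving (h : ℕ) where

  interleave : ℕ → ℕ
  interleave i with i <? h
  ... | yes _ = suc (2 * i)
  ... | no _  = 2 * (i ∸ h)

  interleave-injective : ∀ {i j} → interleave i ≡ interleave j → i ≡ j
  interleave-injective {i} {j} eq with i <? h | j <? h
  ... | yes _   | yes _   = *-cancelˡ-≡ i j 2 (suc-injective eq)
  ... | yes _   | no _    = contradiction (sym eq) (even≢odd (j ∸ h) i)
  ... | no _    | yes _   = contradiction eq (even≢odd (i ∸ h) j)
  ... | no i≮h  | no j≮h  = ∸-cancelʳ-≡ (≮⇒≥ i≮h) (≮⇒≥ j≮h) (*-cancelˡ-≡ _ _ 2 eq)

  interleave-consecutive : ∀ {i j} → suc (interleave i) ≡ interleave j → i + h ≤ j ⊎ j + h ≤ i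
  interleave-consecutive {i} {j} eq with i <? h | j <? h
  ... | yes _   | yes _   = contradiction (sym (suc-injective eq)) (even≢odd j i)
  ... | yes _   | no j≮h  = inj₁ (begin
    i + h          ≤⟨ n≤1+n (i + h) ⟩
    suc i + h      ≡⟨ cong (_+ h) (*-cancelˡ-≡ (suc i) (j ∸ h) 2 (trans (*-suc 2 i) eq)) ⟩
    (j ∸ h) + h    ≡⟨ m∸n+n≡m (≮⇒≥ j≮h) ⟩
    j              ∎)
    where open ≤-Reasoning
  ... | no i≮h  | yes _   = inj₂ (≤-reflexive (begin
    j + h          ≡⟨ cong (_+ h) (*-cancelˡ-≡ j (i ∸ h) 2 (sym (suc-injective eq))) ⟩
    (i ∸ h) + h    ≡⟨ m∸n+n≡m (≮⇒≥ i≮h) ⟩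
    i              ∎))
    where open ≡-Reasoning
  ... | no _    | no _    = contradiction (sym eq) (even≢odd (j ∸ h) (i ∸ h))

  interleave-< : ∀ {N i} → 2 * h ≤ N → N ≤ suc (2 * h) → i < N → interleave i < N
  interleave-< {N} {i} 2h≤N N≤1+2h i<N with i <? h
  ... | yes i<h = ≤-trans (subst (_≤ 2 * h) (*-suc 2 i) (*-monoʳ-≤ 2 i<h)) 2h≤N
  ... | no i≮h  = begin-strict
    2 * (i ∸ h)        ≡⟨ cong ((i ∸ h) +_) (+-identityʳ (i ∸ h)) ⟩
    (i ∸ h) + (i ∸ h)  ≤⟨ +-monoʳ-≤ (i ∸ h) i∸h≤h ⟩
    (i ∸ h) + h        ≡⟨ m∸n+n≡m (≮⇒≥ i≮h) ⟩
    i                  <⟨ i<N ⟩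
    N                  ∎
    where
    open ≤-Reasoning
    i∸h≤h : i ∸ h ≤ h
    i∸h≤h = subst (i ∸ h ≤_) (trans (m+n∸m≡n h (h + 0)) (+-identityʳ h))
                  (∸-monoˡ-≤ h (s≤s⁻¹ (≤-trans i<N N≤1+2h)))

module _ {A : Set} where

  lookup-injective : ∀ {xs : List A} → Unique xs → ∀ {i j} → lookup xs i ≡ lookup xs j → i ≡ j
  lookup-injective {_ ∷ _}  _             {fzero}  {fzero}  _  = refl
  lookup-injective {_ ∷ xs} (x∉xs ∷ _)    {fzero}  {fsuc j} eq = contradiction eq (All.lookup x∉xs (∈-lookup {xs = xs} j))
  lookup-injective {_ ∷ xs} (x∉xs ∷ _)    {fsuc i} {fzero}  eq = contradiction (sym eq) (All.lookup x∉xs (∈-lookup {xs = xs} i))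
  lookup-injective {_ ∷ _}  (_ ∷ unique)  {fsuc i} {fsuc j} eq = cong fsuc (lookup-injective unique eq)

  index-injective : ∀ {xs : List A} {x y} (p : x ∈ xs) (q : y ∈ xs) → index p ≡ index q → x ≡ y
  index-injective {xs} p q eq = trans (lookup-index p) (trans (cong (lookup xs) eq) (sym (lookup-index q)))

  length-filter-≢ : (_≟ᴬ_ : DecidableEquality A) {x : A} {xs : List A} → Unique xs → x ∈ xs →
    suc (length (filter (λ y → ¬? (y ≟ᴬ x)) xs)) ≡ length xs
  length-filter-≢ _≟ᴬ_ {xs = y ∷ ys} (y∉ys ∷ _) (here refl) = cong suc (begin
    length (filter P? (y ∷ ys))  ≡⟨ cong length (filter-reject P? (λ y≢y → y≢y refl)) ⟩
    length (filter P? ys)        ≡⟨ cong length (filter-all P? (All.map (λ y≢z z≡y → y≢z (sym z≡y)) y∉ys)) ⟩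
    length ys                    ∎)
    where
    open ≡-Reasoning
    P? = λ z → ¬? (z ≟ᴬ y)
  length-filter-≢ _≟ᴬ_ {x} {y ∷ ys} (y∉ys ∷ unique) (there x∈ys) =
    cong suc (trans (cong length (filter-accept (λ z → ¬? (z ≟ᴬ x)) (All.lookup y∉ys x∈ys)))
                    (length-filter-≢ _≟ᴬ_ unique x∈ys))

  module _ {P Q : Pred A 0ℓ} (P? : Decidable P) (Q? : Decidable Q) (P⊆Q : ∀ {x} → P x → Q x) where

    length-filter-mono : ∀ xs → length (filter P? xs) ≤ length (filter Q? xs)
    length-filter-mono [] = z≤n
    length-filter-mono (x ∷ xs) with P? x | Q? x
    ... | yes _  | yes _  = s≤s (length-filter-mono xs)
    ... | yes px | no ¬qx = contradiction (P⊆Q px) ¬qx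
    ... | no _   | yes _  = m≤n⇒m≤1+n (length-filter-mono xs)
    ... | no _   | no _   = length-filter-mono xs

    length-filter-< : ∀ {xs} → Any (λ x → Q x × ¬ P x) xs → length (filter P? xs) < length (filter Q? xs)
    length-filter-< {x ∷ xs} (here (qx , ¬px)) with P? x | Q? x
    ... | yes px | _      = contradiction px ¬px
    ... | no _   | yes _  = s≤s (length-filter-mono xs)
    ... | no _   | no ¬qx = contradiction qx ¬qx
    length-filter-< {x ∷ xs} (there any) with P? x | Q? x
    ... | yes _  | yes _  = s≤s (length-filter-< any)
    ... | yes px | no ¬qx = contradiction (P⊆Q px) ¬qx
    ... | no _   | yes _  = m≤n⇒m≤1+n (length-filter-< any)
    ... | no _   | no _   = length-filter-< any

  offset : ∀ {m} → (Fin m → List A) → Fin m → ℕ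
  offset g fzero    = 0
  offset g (fsuc i) = length (g fzero) + offset (g ∘ fsuc) i

  ∈-concat-tabulate⁺ : ∀ {m} (g : Fin m → List A) i {x} → x ∈ g i → x ∈ concat (tabulate g)
  ∈-concat-tabulate⁺ g fzero    x∈gi = ++⁺ˡ x∈gi
  ∈-concat-tabulate⁺ g (fsuc i) x∈gi = ++⁺ʳ (g fzero) (∈-concat-tabulate⁺ (g ∘ fsuc) i x∈gi)

  index-++⁺ˡ : ∀ {xs ys : List A} {x} (p : x ∈ xs) → toℕ (index (++⁺ˡ {ys = ys} p)) ≡ toℕ (index p)
  index-++⁺ˡ (here _)  = refl
  index-++⁺ˡ (there p) = cong suc (index-++⁺ˡ p)

  index-++⁺ʳ : ∀ xs {ys : List A} {x} (p : x ∈ ys) → toℕ (index (++⁺ʳ xs p)) ≡ length xs + toℕ (index p)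
  index-++⁺ʳ []       p = refl
  index-++⁺ʳ (_ ∷ xs) p = cong suc (index-++⁺ʳ xs p)

  index-∈-concat-tabulate⁺ : ∀ {m} (g : Fin m → List A) i {x} (p : x ∈ g i) →
    toℕ (index (∈-concat-tabulate⁺ g i p)) ≡ offset g i + toℕ (index p)
  index-∈-concat-tabulate⁺ g fzero    p = index-++⁺ˡ p
  index-∈-concat-tabulate⁺ g (fsuc i) p = trans (index-++⁺ʳ (g fzero) _)
    (trans (cong (length (g fzero) +_) (index-∈-concat-tabulate⁺ (g ∘ fsuc) i p))
           (sym (+-assoc (length (g fzero)) _ _)))

  ∈-concat-tabulate⁺-close : ∀ {m} (g : Fin m → List A) {i j} → i ≡ j → ∀ {x y} (p : x ∈ g i) (q : y ∈ g j) →
    toℕ (index (∈-concat-tabulate⁺ g i p)) < toℕ (index (∈-concat-tabulate⁺ g j q)) + length (g i)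
  ∈-concat-tabulate⁺-close g {i} refl p q = begin-strict
    toℕ (index (∈-concat-tabulate⁺ g i p))                 ≡⟨ index-∈-concat-tabulate⁺ g i p ⟩
    offset g i + toℕ (index p)                             <⟨ +-monoʳ-< (offset g i) (toℕ<n (index p)) ⟩
    offset g i + length (g i)                              ≤⟨ +-monoˡ-≤ (length (g i)) (m≤m+n (offset g i) _) ⟩
    offset g i + toℕ (index q) + length (g i)              ≡⟨ cong (_+ length (g i)) (index-∈-concat-tabulate⁺ g i q) ⟨
    toℕ (index (∈-concat-tabulate⁺ g i q)) + length (g i)  ∎
    where open ≤-Reasoning

  length-concat-tabulate : ∀ {m} (g : Fin m → List A) → length (concat (tabulate g)) ≡ sum (tabulate (length ∘ g))
  length-concat-tabulate {zero}  g = refl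
  length-concat-tabulate {suc m} g = trans (length-++ (g fzero)) (cong (length (g fzero) +_) (length-concat-tabulate (g ∘ fsuc)))

length-Unique≤ : ∀ {n} {xs : List (Fin n)} → Unique xs → length xs ≤ n
length-Unique≤ unique = injective⇒≤ (lookup-injective unique)

sum-tabulate-suc : ∀ {m} (g : Fin m → ℕ) → sum (tabulate (suc ∘ g)) ≡ sum (tabulate g) + m
sum-tabulate-suc {zero}  g = refl
sum-tabulate-suc {suc m} g = begin
  suc (g fzero + sum (tabulate (suc ∘ g ∘ fsuc)))  ≡⟨ cong (λ s → suc (g fzero + s)) (sum-tabulate-suc (g ∘ fsuc)) ⟩
  suc (g fzero + (sum (tabulate (g ∘ fsuc)) + m))  ≡⟨ cong suc (+-assoc (g fzero) _ m) ⟨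
  suc (sum (tabulate g) + m)                       ≡⟨ +-suc (sum (tabulate g)) m ⟨
  sum (tabulate g) + suc m                         ∎
  where open ≡-Reasoning

HasSize-1⇒≡ : ∀ {n} {P : Fin n → Set} → HasSize P 1 → ∀ {x y} → P x → P y → x ≡ y
HasSize-1⇒≡ ([]          , _ , _   , ())
HasSize-1⇒≡ (_ ∷ _ ∷ _   , _ , _   , ())
HasSize-1⇒≡ (_ ∷ []      , _ , P⇔∈ , _) {x} {y} px py with proj₁ (P⇔∈ x) px | proj₁ (P⇔∈ y) py
... | here x≡z | here y≡z = trans x≡z (sym y≡z)

-- Powers and cyclic subgroups of a finite group

module _ {n : ℕ} (G : FiniteGroup n) where
  open FiniteGroup G
  open IsGroup isGroup using (identityˡ; identityʳ)

  private
    group : Group 0ℓ 0ℓ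
    group = record { Carrier = Fin n ; _≈_ = _≡_ ; _∙_ = _∙_ ; ε = ε ; _⁻¹ = _⁻¹ ; isGroup = isGroup }

  open GroupProperties group using (identityˡ-unique)
  open MonoidMultiplication (Group.monoid group) using (×-homo-+; ×-assocˡ) renaming (_×_ to _·_)

  pow≡· : ∀ x k → pow G x k ≡ k · x
  pow≡· x zero    = refl
  pow≡· x (suc k) = cong (x ∙_) (pow≡· x k)

  pow-+ : ∀ x a b → pow G x (a + b) ≡ pow G x a ∙ pow G x b
  pow-+ x a b = begin
    pow G x (a + b)          ≡⟨ pow≡· x (a + b) ⟩
    (a + b) · x              ≡⟨ ×-homo-+ x a b ⟩
    (a · x) ∙ (b · x)        ≡⟨ cong₂ _∙_ (pow≡· x a) (pow≡· x b) ⟨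
    pow G x a ∙ pow G x b    ∎
    where open ≡-Reasoning

  pow-* : ∀ x a b → pow G (pow G x a) b ≡ pow G x (b * a)
  pow-* x a b = begin
    pow G (pow G x a) b      ≡⟨ pow≡· (pow G x a) b ⟩
    b · pow G x a            ≡⟨ cong (b ·_) (pow≡· x a) ⟩
    b · (a · x)              ≡⟨ ×-assocˡ x b a ⟩
    (b * a) · x              ≡⟨ pow≡· x (b * a) ⟨
    pow G x (b * a)          ∎
    where open ≡-Reasoning

  ⟨⟩-closed-pow : ∀ {g u v} → ⟨_⟩ G g v → IsPowerOf G u v → ⟨_⟩ G g u
  ⟨⟩-closed-pow {g} (a , v≡gᵃ) (b , u≡vᵇ) = b * a , trans u≡vᵇ (trans (cong (λ w → pow G w b) v≡gᵃ) (pow-* g a b))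

  pow-periodic : ∀ x {d} → pow G x d ≡ ε → ∀ q r → pow G x (q * d + r) ≡ pow G x r
  pow-periodic x     xᵈ≡ε zero    r = refl
  pow-periodic x {d} xᵈ≡ε (suc q) r = begin
    pow G x (d + q * d + r)             ≡⟨ cong (pow G x) (+-assoc d (q * d) r) ⟩
    pow G x (d + (q * d + r))           ≡⟨ pow-+ x d (q * d + r) ⟩
    pow G x d ∙ pow G x (q * d + r)     ≡⟨ cong₂ _∙_ xᵈ≡ε (pow-periodic x xᵈ≡ε q r) ⟩
    ε ∙ pow G x r                       ≡⟨ identityˡ (pow G x r) ⟩
    pow G x r                           ∎
    where open ≡-Reasoning

  pow-period : ∀ x → ∃[ d ] 0 < d × d ≤ n × pow G x d ≡ ε
  pow-period x with pigeonhole (n<1+n n) (λ (i : Fin (suc n)) → pow G x (toℕ i))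
  ... | i , j , i<j , xⁱ≡xʲ =
    toℕ j ∸ toℕ i , m<n⇒0<n∸m i<j , ≤-trans (m∸n≤m (toℕ j) (toℕ i)) (s≤s⁻¹ (toℕ<n j)) ,
    identityˡ-unique (pow G x (toℕ j ∸ toℕ i)) (pow G x (toℕ i)) (begin
      pow G x (toℕ j ∸ toℕ i) ∙ pow G x (toℕ i)   ≡⟨ pow-+ x (toℕ j ∸ toℕ i) (toℕ i) ⟨
      pow G x (toℕ j ∸ toℕ i + toℕ i)             ≡⟨ cong (pow G x) (m∸n+n≡m (<⇒≤ i<j)) ⟩
      pow G x (toℕ j)                             ≡⟨ xⁱ≡xʲ ⟨
      pow G x (toℕ i)                             ∎)
    where open ≡-Reasoning

  pow-reduce : ∀ x k → ∃[ r ] r < n × pow G x k ≡ pow G x r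
  pow-reduce x k with pow-period x
  ... | suc d , s≤s z≤n , 1+d≤n , xᵈ≡ε = k % suc d , ≤-trans (m%n<n k (suc d)) 1+d≤n , (begin
    pow G x k                                   ≡⟨ cong (pow G x) (trans (m≡m%n+[m/n]*n k (suc d)) (+-comm (k % suc d) _)) ⟩
    pow G x (k / suc d * suc d + k % suc d)     ≡⟨ pow-periodic x xᵈ≡ε (k / suc d) (k % suc d) ⟩
    pow G x (k % suc d)                         ∎)
    where open ≡-Reasoning

  ⟨⟩? : ∀ g → Decidable (⟨_⟩ G g)
  ⟨⟩? g y = map′ (λ (r , y≡gʳ) → toℕ r , y≡gʳ) below-n (any? (λ (r : Fin n) → y ≟ pow G g (toℕ r)))
    where
    below-n : ⟨_⟩ G g y → ∃[ r ] y ≡ pow G g (toℕ r)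
    below-n (k , y≡gᵏ) with pow-reduce g k
    ... | r , r<n , gᵏ≡gʳ = fromℕ< r<n , trans y≡gᵏ (trans gᵏ≡gʳ (cong (pow G g) (sym (toℕ-fromℕ< r<n))))

  cyclicOrder : Fin n → ℕ
  cyclicOrder g = length (filter (⟨⟩? g) (allFin n))

  cyclicOrder-< : ∀ {g h y} → (∀ x → ⟨_⟩ G g x → ⟨_⟩ G h x) → ⟨_⟩ G h y → ¬ ⟨_⟩ G g y →
    cyclicOrder g < cyclicOrder h
  cyclicOrder-< {g} {h} {y} g⊆h y∈h y∉g =
    length-filter-< (⟨⟩? g) (⟨⟩? h) (g⊆h _) (lose (∈-allFin y) (y∈h , y∉g))

  largest⇒IsMaxCyclicGen : ∀ {h x} → ⟨_⟩ G h x → (∀ h′ → ⟨_⟩ G h′ x → cyclicOrder h′ ≤ cyclicOrder h) →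
    IsMaxCyclicGen G h
  largest⇒IsMaxCyclicGen {h} {x} x∈h largest h′ h⊆h′ y y∈h′ = decidable-stable (⟨⟩? h y) λ y∉h →
    contradiction (largest h′ (h⊆h′ x x∈h)) (<⇒≱ (cyclicOrder-< h⊆h′ y∈h′ y∉h))

  ∈-maximalCyclic : ∀ x → ∃[ h ] IsMaxCyclicGen G h × ⟨_⟩ G h x
  ∈-maximalCyclic x = h , largest⇒IsMaxCyclicGen x∈h largest , x∈h
    where
    x∈? : Decidable (λ g → ⟨_⟩ G g x)
    x∈? g = ⟨⟩? g x
    h : Fin n
    h = argmax cyclicOrder x (filter x∈? (allFin n))
    x∈h : ⟨_⟩ G h x
    x∈h = argmax-all cyclicOrder {P = λ g → ⟨_⟩ G g x} (1 , sym (identityʳ x)) (all-filter x∈? (allFin n))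
    largest : ∀ h′ → ⟨_⟩ G h′ x → cyclicOrder h′ ≤ cyclicOrder h
    largest h′ x∈h′ = All.lookup (f[xs]≤f[argmax] {f = cyclicOrder} x (filter x∈? (allFin n))) (∈-filter⁺ x∈? (∈-allFin h′) x∈h′)

-- L(2,1)-labellings of the power graph

module _ {n : ℕ} (G : FiniteGroup n) where
  open FiniteGroup G

  ε-adjacent : ∀ {x} → x ≢ ε → Adj G ε x
  ε-adjacent x≢ε = x≢ε ∘ sym , inj₁ (0 , refl)

  Adj-sym : ∀ {u v} → Adj G u v → Adj G v u
  Adj-sym (u≢v , inj₁ u∈v) = u≢v ∘ sym , inj₂ u∈v
  Adj-sym (u≢v , inj₂ v∈u) = u≢v ∘ sym , inj₁ v∈u

  ¬IsCyclic⇒nonidentity : ¬ IsCyclic G → ∃[ x ] x ≢ ε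
  ¬IsCyclic⇒nonidentity ¬cyclic with any? (λ x → ¬? (x ≟ ε))
  ... | yes nonidentity = nonidentity
  ... | no  none        = contradiction
    (ε , λ x → 0 , decidable-stable (x ≟ ε) (λ x≢ε → none (x , x≢ε))) ¬cyclic

  IsSpan-exists : ∀ (f : Fin n → ℕ) → Fin n → ∃ (IsSpan G f)
  IsSpan-exists f x = f max ∸ f min , f≤f+span , max , min , sym (m+[n∸m]≡n (min≤f max))
    where
    max = argmax f x (allFin n)
    min = argmin f x (allFin n)
    f≤max : ∀ u → f u ≤ f max
    f≤max u = All.lookup (f[xs]≤f[argmax] {f = f} x (allFin n)) (∈-allFin u)
    min≤f : ∀ u → f min ≤ f u
    min≤f u = All.lookup (f[argmin]≤f[xs] {f = f} x (allFin n)) (∈-allFin u)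
    f≤f+span : ∀ u v → f u ≤ f v + (f max ∸ f min)
    f≤f+span u v = ≤-trans (f≤max u)
      (subst (_≤ f v + (f max ∸ f min)) (m+[n∸m]≡n (min≤f max)) (+-monoˡ-≤ (f max ∸ f min) (min≤f v)))

  module _ {f : Fin n → ℕ} (L21 : IsL21Labeling G f) where

    L21-ε-far : ∀ {x} → x ≢ ε → FarBy 2 (f ε) (f x)
    L21-ε-far x≢ε = proj₁ L21 ε _ (ε-adjacent x≢ε)

    L21-injective : ∀ {u v} → f u ≡ f v → u ≡ v
    L21-injective {u} {v} fu≡fv with u ≟ v | u ≟ ε | v ≟ ε
    ... | yes u≡v | _        | _        = u≡v
    ... | no u≢v  | yes refl | _        = contradiction fu≡fv (FarBy⇒≢ (L21-ε-far (u≢v ∘ sym)))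
    ... | no u≢v  | no u≢ε   | yes refl = contradiction (sym fu≡fv) (FarBy⇒≢ (L21-ε-far u≢ε))
    ... | no u≢v  | no u≢ε   | no v≢ε   = contradiction fu≡fv (FarBy⇒≢ (proj₂ L21 u v
      (u≢v , (λ adj → FarBy⇒≢ (proj₁ L21 u v adj) fu≡fv) , ε , Adj-sym (ε-adjacent u≢ε) , ε-adjacent v≢ε)))

    L21-span≥ : ¬ IsCyclic G → ∀ {s} → IsSpan G f s → n ≤ s
    L21-span≥ ¬cyclic {s} (f≤f+s , u₀ , v₀ , fu₀≡fv₀+s) =
      s≤s⁻¹ (injective-bounded⇒≤ f′ f′-injective a≤f′ f′≤a+s)
      where
      a = f v₀
      a≤f : ∀ x → a ≤ f x
      a≤f x = +-cancelʳ-≤ s a (f x) (subst (_≤ f x + s) fu₀≡fv₀+s (f≤f+s u₀ x))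
      f≤a+s : ∀ x → f x ≤ a + s
      f≤a+s x = f≤f+s x v₀
      x₁≢ε = proj₂ (¬IsCyclic⇒nonidentity ¬cyclic)
      gap = neighbour-towards (a≤f ε) (f≤a+s ε) (a≤f _) (f≤a+s _) (L21-ε-far x₁≢ε)
      c = proj₁ gap
      c-unused : ∀ x → f x ≢ c
      c-unused x fx≡c with x ≟ ε | proj₁ (proj₂ gap)
      ... | yes refl | inj₁ 1+fε≡c = 1+n≢n (trans 1+fε≡c (sym fx≡c))
      ... | yes refl | inj₂ 1+c≡fε = 1+n≢n (trans 1+c≡fε fx≡c)
      ... | no x≢ε   | c~fε        = neighbour-≢-FarBy₂ (L21-ε-far x≢ε) c~fε (sym fx≡c)
      f′ : Fin (suc n) → ℕ
      f′ fzero    = c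
      f′ (fsuc x) = f x
      f′-injective : ∀ {i j} → f′ i ≡ f′ j → i ≡ j
      f′-injective {fzero}  {fzero}  _  = refl
      f′-injective {fzero}  {fsuc y} eq = contradiction (sym eq) (c-unused y)
      f′-injective {fsuc x} {fzero}  eq = contradiction eq (c-unused x)
      f′-injective {fsuc x} {fsuc y} eq = cong fsuc (L21-injective eq)
      a≤f′ : ∀ i → a ≤ f′ i
      a≤f′ fzero    = proj₁ (proj₂ (proj₂ gap))
      a≤f′ (fsuc x) = a≤f x
      f′≤a+s : ∀ i → f′ i ≤ a + s
      f′≤a+s fzero    = proj₂ (proj₂ (proj₂ gap))
      f′≤a+s (fsuc x) = f≤a+s x

  bounded-L21⇒LambdaIs : ¬ IsCyclic G → ∀ {f} → IsL21Labeling G f → (∀ x → f x ≤ n) → LambdaIs G n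
  bounded-L21⇒LambdaIs ¬cyclic {f} L21 f≤n with IsSpan-exists f ε
  ... | s , span@(_ , u , v , fu≡fv+s) =
    (f , L21 , subst (IsSpan G f) s≡n span) , λ _ _ L21′ span′ → L21-span≥ L21′ ¬cyclic span′
    where
    s≡n : s ≡ n
    s≡n = ≤-antisym (≤-trans (m≤n+m s (f v)) (subst (_≤ n) fu≡fv+s (f≤n u))) (L21-span≥ L21 ¬cyclic span)

-- A labelling of span n built from the maximal cyclic subgroups

module BlockLabelling {n : ℕ} (G : FiniteGroup n) {s : ℕ} (gens : Fin (suc s) → Fin n) (ns : Fin (suc s) → ℕ)
    (all-max : AllMaxCyclic G (suc s) gens)
    (sizes : ∀ i → HasSize (⟨_⟩ G (gens i)) (ns i))
    (sorted : ∀ i j → toℕ i ≤ toℕ j → ns j ≤ ns i)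
    (trivial : ∀ i j → ¬ (i ≡ j) → HasSize (λ x → ⟨_⟩ G (gens i) x × ⟨_⟩ G (gens j) x) 1)
    (balanced : ns fzero + suc s ≤ sum (tabulate (λ i → ns (fsuc i))) + 2) where

  open FiniteGroup G

  M : Fin (suc s) → Fin n → Set
  M i = ⟨_⟩ G (gens i)

  ε∈M : ∀ i → M i ε
  ε∈M i = 0 , refl

  M-trivial : ∀ {i j x} → i ≢ j → M i x → M j x → x ≡ ε
  M-trivial {i} {j} i≢j x∈Mi x∈Mj = HasSize-1⇒≡ (trivial i j i≢j) (x∈Mi , x∈Mj) (ε∈M i , ε∈M j)

  ∈-some-M : ∀ x → ∃[ i ] M i x
  ∈-some-M x with ∈-maximalCyclic G x
  ... | h , h-max , x∈h with proj₂ (proj₂ all-max) h h-max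
  ... | i , h≈Mi = i , proj₁ (h≈Mi x) x∈h

  block : Fin n → Fin (suc s)
  block x = proj₁ (∈-some-M x)

  ∈-M-block : ∀ x → M (block x) x
  ∈-M-block x = proj₂ (∈-some-M x)

  block-unique : ∀ {i x} → x ≢ ε → M i x → block x ≡ i
  block-unique {i} {x} x≢ε x∈Mi = decidable-stable (block x ≟ i) λ ne → x≢ε (M-trivial ne (∈-M-block x) x∈Mi)

  Adj⇒same-block : ∀ {u v} → u ≢ ε → v ≢ ε → Adj G u v → block u ≡ block v
  Adj⇒same-block u≢ε v≢ε (_ , inj₁ u∈v) = block-unique u≢ε (⟨⟩-closed-pow G (∈-M-block _) u∈v)
  Adj⇒same-block u≢ε v≢ε (_ , inj₂ v∈u) = sym (block-unique v≢ε (⟨⟩-closed-pow G (∈-M-block _) v∈u))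

  elements : Fin (suc s) → List (Fin n)
  elements i = proj₁ (sizes i)

  elements-unique : ∀ i → Unique (elements i)
  elements-unique i = proj₁ (proj₂ (sizes i))

  ∈-elements⇔ : ∀ i x → (M i x → x ∈ elements i) × (x ∈ elements i → M i x)
  ∈-elements⇔ i = proj₁ (proj₂ (proj₂ (sizes i)))

  nonidentity? : Decidable (_≢ ε)
  nonidentity? x = ¬? (x ≟ ε)

  B : Fin (suc s) → List (Fin n)
  B i = filter nonidentity? (elements i)

  ∈-B⁺ : ∀ {i x} → M i x → x ≢ ε → x ∈ B i
  ∈-B⁺ {i} {x} x∈Mi x≢ε = ∈-filter⁺ nonidentity? (proj₁ (∈-elements⇔ i x) x∈Mi) x≢ε

  ∈-B⁻ : ∀ {i x} → x ∈ B i → M i x × x ≢ ε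
  ∈-B⁻ {i} {x} x∈Bi with ∈-filter⁻ nonidentity? x∈Bi
  ... | x∈elements , x≢ε = proj₂ (∈-elements⇔ i x) x∈elements , x≢ε

  suc-length-B : ∀ i → suc (length (B i)) ≡ ns i
  suc-length-B i = trans (length-filter-≢ _≟_ (elements-unique i) (proj₁ (∈-elements⇔ i ε) (ε∈M i)))
                         (proj₂ (proj₂ (proj₂ (sizes i))))

  L : List (Fin n)
  L = concat (tabulate B)

  N : ℕ
  N = length L

  ∈-L : ∀ {x} → x ≢ ε → x ∈ L
  ∈-L {x} x≢ε = ∈-concat-tabulate⁺ B (block x) (∈-B⁺ (∈-M-block x) x≢ε)

  position : ∀ {x} → x ≢ ε → ℕ
  position x≢ε = toℕ (index (∈-L x≢ε))

  ε∉L : ε ∉ L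
  ε∉L ε∈L with ∈-concat⁻′ (tabulate B) ε∈L
  ... | ys , ε∈ys , ys∈tabulate with ∈-tabulate⁻ {f = B} ys∈tabulate
  ... | i , refl = proj₂ (∈-B⁻ ε∈ys) refl

  L-unique : Unique L
  L-unique = Uniqueₚ.concat⁺ (Allₚ.tabulate⁺ (λ i → Uniqueₚ.filter⁺ nonidentity? (elements-unique i))) (AllPairsₚ.tabulate⁺ B-disjoint)
    where
    B-disjoint : ∀ {i j} → i ≢ j → Disjoint (B i) (B j)
    B-disjoint i≢j (x∈Bi , x∈Bj) = proj₂ (∈-B⁻ x∈Bi) (M-trivial i≢j (proj₁ (∈-B⁻ x∈Bi)) (proj₁ (∈-B⁻ x∈Bj)))

  N<n : N < n
  N<n = length-Unique≤ (¬Any⇒All¬ L ε∉L ∷ L-unique)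

  length-B≤length-B₀ : ∀ k → length (B k) ≤ length (B fzero)
  length-B≤length-B₀ k = s≤s⁻¹ (subst₂ _≤_ (sym (suc-length-B k)) (sym (suc-length-B fzero)) (sorted fzero k z≤n))

  length-B₀≤rest : length (B fzero) ≤ sum (tabulate (length ∘ B ∘ fsuc))
  length-B₀≤rest = +-cancelʳ-≤ (s + 2) ℓ₀ rest (begin
    ℓ₀ + (s + 2)                                  ≡⟨ trans (cong (ℓ₀ +_) (+-comm s 2)) (+-suc ℓ₀ (suc s)) ⟩
    suc ℓ₀ + suc s                                ≡⟨ cong (_+ suc s) (suc-length-B fzero) ⟩
    ns fzero + suc s                              ≤⟨ balanced ⟩
    sum (tabulate (ns ∘ fsuc)) + 2                ≡⟨ cong (λ xs → sum xs + 2) (tabulate-cong (sym ∘ suc-length-B ∘ fsuc)) ⟩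
    sum (tabulate (suc ∘ length ∘ B ∘ fsuc)) + 2  ≡⟨ cong (_+ 2) (sum-tabulate-suc (length ∘ B ∘ fsuc)) ⟩
    rest + s + 2                                  ≡⟨ +-assoc rest s 2 ⟩
    rest + (s + 2)                                ∎)
    where
    open ≤-Reasoning
    ℓ₀ = length (B fzero)
    rest = sum (tabulate (length ∘ B ∘ fsuc))

  length-B≤⌊N/2⌋ : ∀ k → length (B k) ≤ ⌊ N /2⌋
  length-B≤⌊N/2⌋ k = m+m≤n⇒m≤⌊n/2⌋ (begin
    length (B k) + length (B k)                              ≤⟨ +-mono-≤ (length-B≤length-B₀ k)
                                                                  (≤-trans (length-B≤length-B₀ k) length-B₀≤rest) ⟩
    length (B fzero) + sum (tabulate (length ∘ B ∘ fsuc))    ≡⟨ length-concat-tabulate B ⟨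
    N                                                        ∎)
    where open ≤-Reasoning

  open Interleaving ⌊ N /2⌋

  label : Fin n → ℕ
  label x with x ≟ ε
  ... | yes _  = 0
  ... | no x≢ε = 2 + interleave (position x≢ε)

  label≤n : ∀ x → label x ≤ n
  label≤n x with x ≟ ε
  ... | yes _  = z≤n
  ... | no x≢ε = ≤-trans (s≤s (interleave-< 2h≤N N≤1+2h (toℕ<n (index (∈-L x≢ε))))) N<n
    where
    2h≤N = proj₁ (⌊n/2⌋-bounds N)
    N≤1+2h = proj₂ (⌊n/2⌋-bounds N)

  label-injective : ∀ {u v} → label u ≡ label v → u ≡ v
  label-injective {u} {v} eq with u ≟ ε | v ≟ ε
  ... | yes u≡ε | yes v≡ε = trans u≡ε (sym v≡ε)
  label-injective () | yes _ | no _
  label-injective () | no _  | yes _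
  ... | no u≢ε  | no v≢ε  = index-injective (∈-L u≢ε) (∈-L v≢ε)
    (toℕ-injective (interleave-injective (suc-injective (suc-injective eq))))

  positions-close : ∀ {u v} (u≢ε : u ≢ ε) (v≢ε : v ≢ ε) → Adj G u v → position u≢ε < position v≢ε + ⌊ N /2⌋
  positions-close u≢ε v≢ε adj = ≤-trans (∈-concat-tabulate⁺-close B (Adj⇒same-block u≢ε v≢ε adj) _ _)
                                        (+-monoʳ-≤ _ (length-B≤⌊N/2⌋ _))

  label-nonconsecutive : ∀ {u v} → Adj G u v → suc (label u) ≢ label v
  label-nonconsecutive {u} {v} adj with u ≟ ε | v ≟ ε
  ... | yes _  | yes _  = λ ()
  ... | yes _  | no _   = λ ()
  ... | no _   | yes _  = λ ()
  ... | no u≢ε | no v≢ε = λ eq → case interleave-consecutive (suc-injective (suc-injective eq)) of λ where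
    (inj₁ p+h≤q) → <⇒≱ (positions-close v≢ε u≢ε (Adj-sym G adj)) p+h≤q
    (inj₂ q+h≤p) → <⇒≱ (positions-close u≢ε v≢ε adj) q+h≤p

  label-L21 : IsL21Labeling G label
  label-L21 = (λ u v adj → FarBy₂-intro (label-≢ (proj₁ adj)) (label-nonconsecutive adj) (label-nonconsecutive (Adj-sym G adj))) ,
              (λ u v dist2 → ≢⇒FarBy₁ (label-≢ (proj₁ dist2)))
    where
    label-≢ : ∀ {u v} → u ≢ v → label u ≢ label v
    label-≢ u≢v = u≢v ∘ label-injective

lemma3p4 : (n : ℕ) (G : FiniteGroup n) → ¬ IsCyclic G →
    (s : ℕ) (gens : Fin (suc s) → Fin n) (ns : Fin (suc s) → ℕ) →
    AllMaxCyclic G (suc s) gens →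
    (∀ i → HasSize (⟨_⟩ G (gens i)) (ns i)) →
    (∀ i j → toℕ i ≤ toℕ j → ns j ≤ ns i) →
    (∀ i j → ¬ (i ≡ j) → HasSize (λ x → ⟨_⟩ G (gens i) x × ⟨_⟩ G (gens j) x) 1) →
    ns fzero + suc s ≤ sum (tabulate (λ i → ns (fsuc i))) + 2 →
    LambdaIs G n
lemma3p4 n G ¬cyclic s gens ns all-max sizes sorted trivial balanced =
  bounded-L21⇒LambdaIs G ¬cyclic label-L21 label≤n
  where open BlockLabelling G gens ns all-max sizes sorted trivial balanced
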